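{- Let the integers $F(n,k)$, for $n\ge 0$ and $0\le k\le n$, be defined by $F(0,0)=1$, $F(n,n)=0$ for $n>0$, and, for $n>0$ and $0\le k<n$, $$F(n,k)=\sum_{j=0}^{k}\binom{k-j+2}{2}F(n-1,j).$$ For integers $p\ge 1$, $q\ge 0$, $n\ge 0$ let $\mathsf{A}_n(p,q)=\frac{q}{pn+q}\binom{pn+q}{n}$ (Fuss–Catalan numbers). Then for every $n>0$: (i) $\sum_{k=0}^{n}F(n,k)=\mathsf{A}_n(4,1)=\frac{1}{4n+1}\binom{4n+1}{n}$; (ii) $\sum_{k=0}^{n}F(n,k)\binom{n-k+3}{3}=\mathsf{A}_n(4,4)=\frac{4}{4n+4}\binom{4n+4}{n}$; (iii) $F(n,n-1)=\mathsf{A}_{n-1}(4,3)=\frac{3}{4n-1}\binom{4n-1}{n-1}$. -}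

module Defs where

open import Data.Nat using (ℕ; zero; suc; _+_; _*_; _∸_; _<ᵇ_)
open import Data.Nat.Combinatorics using (_C_)
open import Data.Bool using (if_then_else_)
open import Data.Integer using (+_)
open import Data.Rational using (ℚ; _/_; 0ℚ)

sumTo : ℕ → (ℕ → ℕ) → ℕ
sumTo zero    f = f 0
sumTo (suc k) f = sumTo k f + f (suc k)

-- Only meaningful for 0 ≤ k ≤ n; for k > n we set it to 0
-- (these values are never used by the recursion nor by the theorem).
F : ℕ → ℕ → ℕ
F zero    zero    = 1
F zero    (suc k) = 0
F (suc n) k = if k <ᵇ suc n
  then sumTo k (λ j → (((k ∸ j) + 2) C 2) * F n j)
  else 0

-- Fuss–Catalan number A_n(p,q) = q/(pn+q) * C(pn+q, n), as a rational.
-- (When pn+q = 0 the formula is undefined; we return 0, never used here.)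
A : ℕ → ℕ → ℕ → ℚ
A n p q with p * n + q
... | zero  = 0ℚ
... | suc m = (+ (q * (suc m C n))) / suc m

toℚ : ℕ → ℚ
toℚ k = (+ k) / 1

-- F(n,k) is a ballot number: F(n,k) + 3·C(3n+k−1, k−1) = C(3n+k−1, k) for n ≥ 1
-- (stated additively, so no truncated subtraction occurs). The recursion
-- convolves F(n−1,·) with the coefficients C(i+2,2) of (1−x)⁻³, which sends both
-- binomial families C(u+k,k) and C(u+k,k−1) to the same families with u raised
-- by 3; the boundary value F(n,n) = 0 is the ballot formula on the diagonal.
-- The three quantities of the theorem are again of the form
-- C(u+n,n) − 3·C(u+n,n−1) with u + 1 = 3n + r, r = 1, 4, 3, and by absorption
-- n·C(u+n,n) = (u+1)·C(u+n,n−1) this difference equals r/(4n+r)·C(4n+r,n).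
module Submission where

open import Defs
open import Data.Nat using (ℕ; zero; suc; _+_; _*_; _∸_; _≤_; _<ᵇ_; z≤n; s≤s)
open import Data.Nat.Properties
open import Data.Nat.Combinatorics using (_C_; nCn≡1; nCk+nC[k+1]≡[n+1]C[k+1])
open import Data.Nat.Tactic.RingSolver using (solve-∀)
open import Algebra.Properties.CommutativeSemigroup +-commutativeSemigroup
  using (interchange; xy∙z≈y∙xz)
open import Data.Bool using (false)
open import Data.Bool.Properties using (T-≡)
open import Data.Product using (_×_; _,_)
open import Data.Sum using (inj₁; inj₂)
open import Data.Integer using () renaming (+_ to pos)
open import Data.Integer.Properties using (pos-*)
open import Data.Rational using (_/_)
open import Data.Rational.Unnormalised using (mkℚᵘ; *≡*)
open import Data.Rational.Properties using (fromℚᵘ-cong)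
open import Function.Bundles using (Equivalence)
open import Relation.Binary.PropositionalEquality

open ≡-Reasoning

sumTo-cong : ∀ k {f g : ℕ → ℕ} → (∀ j → j ≤ k → f j ≡ g j) → sumTo k f ≡ sumTo k g
sumTo-cong zero    f≗g = f≗g 0 z≤n
sumTo-cong (suc k) f≗g =
  cong₂ _+_ (sumTo-cong k (λ j j≤k → f≗g j (m≤n⇒m≤1+n j≤k))) (f≗g (suc k) ≤-refl)

sumTo-+ : ∀ k f g → sumTo k f + sumTo k g ≡ sumTo k (λ j → f j + g j)
sumTo-+ zero    f g = refl
sumTo-+ (suc k) f g =
  trans (interchange (sumTo k f) (f (suc k)) (sumTo k g) (g (suc k)))
        (cong (_+ (f (suc k) + g (suc k))) (sumTo-+ k f g))

sumTo-*ˡ : ∀ k c f → c * sumTo k f ≡ sumTo k (λ j → c * f j)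
sumTo-*ˡ zero    c f = refl
sumTo-*ˡ (suc k) c f =
  trans (*-distribˡ-+ c (sumTo k f) (f (suc k))) (cong (_+ (c * f (suc k))) (sumTo-*ˡ k c f))

shift : (ℕ → ℕ) → ℕ → ℕ
shift f zero    = 0
shift f (suc k) = f k

sumTo-shift : ∀ f k → sumTo (suc k) (shift f) ≡ sumTo k f
sumTo-shift f zero    = refl
sumTo-shift f (suc k) = cong (_+ f (suc k)) (sumTo-shift f k)

-- pascal a k = (a + k) C k, generated by Pascal's rule so that recursion is structural.
pascal : ℕ → ℕ → ℕ
pascal zero    k       = 1
pascal (suc a) zero    = 1
pascal (suc a) (suc k) = pascal a (suc k) + pascal (suc a) k

pascal-zeroʳ : ∀ a → pascal a 0 ≡ 1
pascal-zeroʳ zero    = refl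
pascal-zeroʳ (suc a) = refl

pascal-oneˡ : ∀ k → pascal 1 k ≡ suc k
pascal-oneˡ zero    = refl
pascal-oneˡ (suc k) = cong suc (pascal-oneˡ k)

pascal-comm : ∀ a k → pascal a k ≡ pascal k a
pascal-comm zero    zero    = refl
pascal-comm zero    (suc k) = refl
pascal-comm (suc a) zero    = refl
pascal-comm (suc a) (suc k) =
  trans (cong₂ _+_ (pascal-comm a (suc k)) (pascal-comm (suc a) k))
        (+-comm (pascal (suc k) a) (pascal k (suc a)))

pascal≡C : ∀ a k → pascal a k ≡ (a + k) C k
pascal≡C zero    k       = sym (nCn≡1 k)
pascal≡C (suc a) zero    = refl
pascal≡C (suc a) (suc k) = begin
  pascal a (suc k) + pascal (suc a) k          ≡⟨ cong₂ _+_ (pascal≡C a (suc k)) (pascal≡C (suc a) k) ⟩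
  (a + suc k) C suc k + (suc a + k) C k        ≡⟨ +-comm ((a + suc k) C suc k) _ ⟩
  (suc a + k) C k + (a + suc k) C suc k        ≡⟨ cong (λ i → i C k + (a + suc k) C suc k) (sym (+-suc a k)) ⟩
  (a + suc k) C k + (a + suc k) C suc k        ≡⟨ nCk+nC[k+1]≡[n+1]C[k+1] (a + suc k) k ⟩
  suc (a + suc k) C suc k                      ∎

C≡pascal : ∀ a d → (d + a) C a ≡ pascal a d
C≡pascal a d = sym (trans (pascal-comm a d) (pascal≡C d a))

sumTo-pascal : ∀ a k → sumTo k (pascal a) ≡ pascal (suc a) k
sumTo-pascal a zero    = pascal-zeroʳ a
sumTo-pascal a (suc k) =
  trans (cong (_+ pascal a (suc k)) (sumTo-pascal a k)) (+-comm (pascal (suc a) k) _)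

sumTo-shift-pascal : ∀ a k → sumTo k (shift (pascal a)) ≡ shift (pascal (suc a)) k
sumTo-shift-pascal a zero    = refl
sumTo-shift-pascal a (suc k) = trans (sumTo-shift (pascal a) k) (sumTo-pascal a k)

pascal-absorb : ∀ a k → suc k * pascal a (suc k) ≡ suc a * pascal (suc a) k
pascal-absorb zero    k = trans (*-identityʳ (suc k)) (sym (trans (*-identityˡ _) (pascal-oneˡ k)))
pascal-absorb (suc a) zero =
  trans (*-identityˡ _) (trans (trans (pascal-comm (suc a) 1) (pascal-oneˡ (suc a)))
                               (sym (*-identityʳ (suc (suc a)))))
pascal-absorb (suc a) (suc k) = begin
  suc (suc k) * (X + Y)                ≡⟨ *-distribˡ-+ (suc (suc k)) X Y ⟩
  suc (suc k) * X + suc (suc k) * Y    ≡⟨ cong (_+ suc (suc k) * Y) (pascal-absorb a (suc k)) ⟩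
  suc a * Y + suc (suc k) * Y          ≡⟨ regroup a k Y ⟩
  suc (suc a) * Y + suc k * Y          ≡⟨ cong (suc (suc a) * Y +_) (pascal-absorb (suc a) k) ⟩
  suc (suc a) * Y + suc (suc a) * Z    ≡⟨ sym (*-distribˡ-+ (suc (suc a)) Y Z) ⟩
  suc (suc a) * (Y + Z)                ∎
  where
  X Y Z : ℕ
  X = pascal a (suc (suc k))
  Y = pascal (suc a) (suc k)
  Z = pascal (suc (suc a)) k
  regroup : ∀ a k y → (1 + a) * y + (2 + k) * y ≡ (2 + a) * y + (1 + k) * y
  regroup = solve-∀

-- conv a f k is the coefficient of xᵏ in f(x)/(1−x)ᵃ⁺¹.
conv : ℕ → (ℕ → ℕ) → ℕ → ℕ
conv a f k = sumTo k (λ j → pascal a (k ∸ j) * f j)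

conv-cong : ∀ a k {f g : ℕ → ℕ} → (∀ j → j ≤ k → f j ≡ g j) → conv a f k ≡ conv a g k
conv-cong a k f≗g = sumTo-cong k (λ j j≤k → cong (pascal a (k ∸ j) *_) (f≗g j j≤k))

conv-linear : ∀ a c f g k → conv a f k + c * conv a g k ≡ conv a (λ j → f j + c * g j) k
conv-linear a c f g k =
  trans (cong (conv a f k +_) (sumTo-*ˡ k c _))
  (trans (sumTo-+ k _ _) (sumTo-cong k (λ j _ → distrib c (pascal a (k ∸ j)) (f j) (g j))))
  where
  distrib : ∀ c p x y → p * x + c * (p * y) ≡ p * (x + c * y)
  distrib = solve-∀

conv-zero : ∀ f k → conv 0 f k ≡ sumTo k f
conv-zero f k = sumTo-cong k (λ j _ → *-identityˡ (f j))

conv-suc : ∀ a f k → conv (suc a) f k ≡ sumTo k (conv a f)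
conv-suc a f zero    = cong (_* f 0) (sym (pascal-zeroʳ a))
conv-suc a f (suc k) = begin
  sumTo k (λ j → pascal (suc a) (suc k ∸ j) * f j) + pascal (suc a) (k ∸ k) * f (suc k)
    ≡⟨ cong₂ _+_ (sumTo-cong k pascal-rule) (cong (λ i → pascal (suc a) i * f (suc k)) (n∸n≡0 k)) ⟩
  sumTo k (λ j → pascal a (suc k ∸ j) * f j + pascal (suc a) (k ∸ j) * f j) + 1 * f (suc k)
    ≡⟨ cong (_+ 1 * f (suc k)) (sym (sumTo-+ k _ _)) ⟩
  (X + conv (suc a) f k) + 1 * f (suc k)
    ≡⟨ cong (λ s → (X + s) + 1 * f (suc k)) (conv-suc a f k) ⟩
  (X + sumTo k (conv a f)) + 1 * f (suc k)
    ≡⟨ xy∙z≈y∙xz X (sumTo k (conv a f)) _ ⟩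
  sumTo k (conv a f) + (X + 1 * f (suc k))
    ≡⟨ cong (λ p → sumTo k (conv a f) + (X + p * f (suc k))) (sym pascal-k∸k) ⟩
  sumTo k (conv a f) + conv a f (suc k)
    ∎
  where
  X : ℕ
  X = sumTo k (λ j → pascal a (suc k ∸ j) * f j)
  pascal-rule : ∀ j → j ≤ k →
    pascal (suc a) (suc k ∸ j) * f j ≡ pascal a (suc k ∸ j) * f j + pascal (suc a) (k ∸ j) * f j
  pascal-rule j j≤k rewrite +-∸-assoc 1 j≤k = *-distribʳ-+ (f j) (pascal a (suc (k ∸ j))) (pascal (suc a) (k ∸ j))
  pascal-k∸k : pascal a (k ∸ k) ≡ 1
  pascal-k∸k = trans (cong (pascal a) (n∸n≡0 k)) (pascal-zeroʳ a)

conv-sumTo-closed : (g : ℕ → ℕ → ℕ) → (∀ b k → sumTo k (g b) ≡ g (suc b) k) →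
                    ∀ a b k → conv a (g b) k ≡ g (suc (a + b)) k
conv-sumTo-closed g sumTo-g zero    b k = trans (conv-zero (g b) k) (sumTo-g b k)
conv-sumTo-closed g sumTo-g (suc a) b k =
  trans (conv-suc a (g b) k)
  (trans (sumTo-cong k (λ j _ → conv-sumTo-closed g sumTo-g a b j)) (sumTo-g (suc (a + b)) k))

conv-pascal : ∀ a b k → conv a (pascal b) k ≡ pascal (suc (a + b)) k
conv-pascal = conv-sumTo-closed pascal sumTo-pascal

conv-shift-pascal : ∀ a b k → conv a (shift (pascal b)) k ≡ shift (pascal (suc (a + b))) k
conv-shift-pascal = conv-sumTo-closed (λ b → shift (pascal b)) sumTo-shift-pascal

conv-ballot : ∀ a c u k {f : ℕ → ℕ} →
  (∀ j → j ≤ k → f j + c * shift (pascal (suc u)) j ≡ pascal u j) →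
  conv a f k + c * shift (pascal (suc (a + suc u))) k ≡ pascal (suc (a + u)) k
conv-ballot a c u k {f} ballot = begin
  conv a f k + c * shift (pascal (suc (a + suc u))) k
    ≡⟨ cong (λ s → conv a f k + c * s) (sym (conv-shift-pascal a (suc u) k)) ⟩
  conv a f k + c * conv a (shift (pascal (suc u))) k
    ≡⟨ conv-linear a c f _ k ⟩
  conv a (λ j → f j + c * shift (pascal (suc u)) j) k
    ≡⟨ conv-cong a k ballot ⟩
  conv a (pascal u) k
    ≡⟨ conv-pascal a u k ⟩
  pascal (suc (a + u)) k
    ∎

ballot-diagonal : ∀ k u → suc u ≡ suc k * 3 → 3 * pascal (suc u) k ≡ pascal u (suc k)
ballot-diagonal k u u+1≡3[k+1] = *-cancelˡ-≡ _ _ (suc k) (begin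
  suc k * (3 * pascal (suc u) k)   ≡⟨ sym (*-assoc (suc k) 3 (pascal (suc u) k)) ⟩
  suc k * 3 * pascal (suc u) k     ≡⟨ cong (_* pascal (suc u) k) (sym u+1≡3[k+1]) ⟩
  suc u * pascal (suc u) k         ≡⟨ sym (pascal-absorb u k) ⟩
  suc k * pascal u (suc k)         ∎)

F-suc≡conv : ∀ n k → k ≤ n → F (suc n) k ≡ conv 2 (F n) k
F-suc≡conv n k k≤n rewrite Equivalence.to T-≡ (<⇒<ᵇ (s≤s k≤n)) =
  sumTo-cong k (λ j _ → cong (_* F n j) (C≡pascal 2 (k ∸ j)))

n<ᵇn≡false : ∀ n → (n <ᵇ n) ≡ false
n<ᵇn≡false zero    = refl
n<ᵇn≡false (suc n) = n<ᵇn≡false n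

F-diagonal : ∀ n → F (suc n) (suc n) ≡ 0
F-diagonal n rewrite n<ᵇn≡false n = refl

-- With n = m + 1, the parameter 2 + m * 3 = 3n − 1 is written so that the
-- parameters produced by conv are definitionally the ones needed.
F-ballot : ∀ m k → k ≤ suc m →
  F (suc m) k + 3 * shift (pascal (3 + m * 3)) k ≡ pascal (2 + m * 3) k
F-ballot zero    zero          _  = refl
F-ballot zero    (suc zero)    _  = refl
F-ballot zero    (suc (suc k)) (s≤s ())
F-ballot (suc m) k k≤ with m≤n⇒m<n∨m≡n k≤
... | inj₁ (s≤s k≤n) =
  trans (cong (_+ 3 * shift (pascal (3 + suc m * 3)) k) (F-suc≡conv (suc m) k k≤n))
        (conv-ballot 2 3 (2 + m * 3) k (λ j j≤k → F-ballot m j (≤-trans j≤k k≤n)))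
... | inj₂ refl rewrite F-diagonal (suc m) = ballot-diagonal (suc m) (5 + m * 3) refl

ballot-arith : ∀ n r S X Y → S + 3 * Y ≡ X → n * X ≡ (3 * n + r) * Y →
               S * (4 * n + r) ≡ r * (X + Y)
ballot-arith n r S X Y ballot absorb = +-cancelʳ-≡ (3 * Y * N) _ _ (begin
  S * N + 3 * Y * N               ≡⟨ sym (*-distribʳ-+ N S (3 * Y)) ⟩
  (S + 3 * Y) * N                 ≡⟨ cong (_* N) ballot ⟩
  X * N                           ≡⟨ expand n r X ⟩
  4 * (n * X) + r * X             ≡⟨ cong (λ z → 4 * z + r * X) absorb ⟩
  4 * ((3 * n + r) * Y) + r * X   ≡⟨ regroup n r X Y ⟩
  r * (X + Y) + 3 * Y * N         ∎)
  where
  N : ℕ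
  N = 4 * n + r
  expand : ∀ n r X → X * (4 * n + r) ≡ 4 * (n * X) + r * X
  expand = solve-∀
  regroup : ∀ n r X Y → 4 * ((3 * n + r) * Y) + r * X ≡ r * (X + Y) + 3 * Y * (4 * n + r)
  regroup = solve-∀

toℚ-from-product : ∀ a b d → a * suc d ≡ b → toℚ a ≡ pos b / suc d
toℚ-from-product a b d a*[d+1]≡b = fromℚᵘ-cong {mkℚᵘ (pos a) 0} {mkℚᵘ (pos b) d}
  (*≡* (trans (sym (pos-* a (suc d)))
        (trans (cong pos (trans a*[d+1]≡b (sym (*-identityʳ b)))) (pos-* b 1))))

A-unfold : ∀ n p q M → p * n + q ≡ suc M → A n p q ≡ pos (q * (suc M C n)) / suc M
A-unfold n p q M eq rewrite eq = refl

ballot-fussCatalan : ∀ r m S →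
  S + 3 * pascal (suc (r + suc m * 3)) m ≡ pascal (r + suc m * 3) (suc m) →
  toℚ S ≡ A (suc m) 4 (suc r)
ballot-fussCatalan r m S ballot = begin
  toℚ S                                   ≡⟨ toℚ-from-product S _ M S*[M+1] ⟩
  pos (suc r * (suc M C suc m)) / suc M   ≡⟨ sym (A-unfold (suc m) 4 (suc r) M (size r m)) ⟩
  A (suc m) 4 (suc r)                     ∎
  where
  u M X Y : ℕ
  u = r + suc m * 3
  M = r + suc m * 4
  X = pascal u (suc m)
  Y = pascal (suc u) m
  size : ∀ r m → 4 * suc m + suc r ≡ suc (r + suc m * 4)
  size = solve-∀
  u+1 : ∀ r m → suc (r + suc m * 3) ≡ 3 * suc m + suc r
  u+1 = solve-∀
  u+1+n : ∀ r m → suc (r + suc m * 3) + suc m ≡ suc (r + suc m * 4)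
  u+1+n = solve-∀
  X+Y≡C : X + Y ≡ suc M C suc m
  X+Y≡C = trans (pascal≡C (suc u) (suc m)) (cong (_C suc m) (u+1+n r m))
  S*[M+1] : S * suc M ≡ suc r * (suc M C suc m)
  S*[M+1] = begin
    S * suc M                     ≡⟨ cong (S *_) (sym (size r m)) ⟩
    S * (4 * suc m + suc r)       ≡⟨ ballot-arith (suc m) (suc r) S X Y ballot
                                       (trans (pascal-absorb u m) (cong (_* Y) (u+1 r m))) ⟩
    suc r * (X + Y)               ≡⟨ cong (suc r *_) X+Y≡C ⟩
    suc r * (suc M C suc m)       ∎

conv-F-ballot : ∀ a m →
  conv a (F (suc m)) (suc m) + 3 * pascal (suc (a + (3 + m * 3))) m ≡ pascal (suc (a + (2 + m * 3))) (suc m)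
conv-F-ballot a m = conv-ballot a 3 (2 + m * 3) (suc m) (F-ballot m)

F-sum : ∀ m → toℚ (sumTo (suc m) (F (suc m))) ≡ A (suc m) 4 1
F-sum m = ballot-fussCatalan 0 m (sumTo (suc m) (F (suc m)))
  (trans (cong (_+ 3 * pascal (4 + m * 3) m) (sym (conv-zero (F (suc m)) (suc m))))
         (conv-F-ballot 0 m))

F-weighted-sum : ∀ m →
  toℚ (sumTo (suc m) (λ k → F (suc m) k * ((suc m ∸ k + 3) C 3))) ≡ A (suc m) 4 4
F-weighted-sum m = ballot-fussCatalan 3 m weighted-sum
  (trans (cong (_+ 3 * pascal (7 + m * 3) m) weighted-sum≡conv) (conv-F-ballot 3 m))
  where
  n : ℕ
  n = suc m
  weighted-sum : ℕ
  weighted-sum = sumTo n (λ k → F n k * ((n ∸ k + 3) C 3))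
  weighted-sum≡conv : weighted-sum ≡ conv 3 (F n) n
  weighted-sum≡conv =
    sumTo-cong n (λ k _ → trans (cong (F n k *_) (C≡pascal 3 (n ∸ k))) (*-comm (F n k) _))

F-subdiagonal : ∀ m → toℚ (F (suc m) m) ≡ A m 4 3
F-subdiagonal zero    = refl
F-subdiagonal (suc m) =
  ballot-fussCatalan 2 m (F (suc (suc m)) (suc m)) (F-ballot (suc m) (suc m) (n≤1+n (suc m)))

theorem3 : ∀ (n : ℕ) → 1 ≤ n →
    (toℚ (sumTo n (λ k → F n k)) ≡ A n 4 1)
    × (toℚ (sumTo n (λ k → F n k * (((n ∸ k) + 3) C 3))) ≡ A n 4 4)
    × (toℚ (F n (n ∸ 1)) ≡ A (n ∸ 1) 4 3)
theorem3 (suc m) _ = F-sum m , F-weighted-sum m , F-subdiagonal m
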